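{- Let $k\ge 3$ and let $n_1,\dots,n_k$ be positive integers with $n_1=\max\{n_i : i\in[1,k]\}$ and $n_1\ge \sum_{i=2}^k n_i$. Let $G=K_{n_1,n_2,\dots,n_k}$ be the complete $k$-partite graph with partite sets $V_1,\dots,V_k$, $|V_i|=n_i$. Let $H$ be the subgraph of $G$ induced by $\bigcup_{i=2}^k V_i$, let $H'$ be any subgraph of $H$, and let $G'$ be the graph with $V(G')=V(G)$ and $E(G')=E(G)\setminus E(H')$. Then $\mathrm{str}(G')=\mathrm{str}(G)$.
   Context: Graphs are finite, without loops or multiple edges. For integers $a\le b$, $[a,b]$ denotes $\{x\in\mathbb{Z}: a\le x\le b\}$. A numbering of a graph $G$ of order $n$ is a bijection $f:V(G)\to[1,n]$. For a numbering $f$, $\mathrm{str}_f(G)=\max\{f(u)+f(v): uv\in E(G)\}$, and the strength of $G$ is $\mathrm{str}(G)=\min\{\mathrm{str}_f(G): f \text{ a numbering of } G\}$ (with $\mathrm{str}(G)=+\infty$ if $G$ has no edges). -}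

module Defs where

open import Level using (0ℓ)
open import Data.Nat using (ℕ; zero; suc; _+_; _≤_)
open import Data.Fin using (Fin; zero; suc)
open import Data.Product using (Σ; _×_; ∃; _,_; proj₁)
open import Function.Bundles using (_⤖_; Bijection)
open import Relation.Binary.PropositionalEquality using (_≡_)
open import Relation.Nullary using (¬_)
open import Data.Fin using (toℕ)

record Graph : Set₁ where
  field
    V     : Set
    Adj   : V → V → Set
    sym   : ∀ {u v} → Adj u v → Adj v u
    irr   : ∀ {v} → ¬ Adj v v

open Graph public

sumF : ∀ {k} → (Fin k → ℕ) → ℕ
sumF {zero}  f = 0
sumF {suc k} f = f zero + sumF (λ i → f (suc i))

-- A numbering of a graph of order n: a bijection V(G) → [1,n].
-- We model [1,n] as Fin n via the label  1 + toℕ.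
Numbering : (G : Graph) → (n : ℕ) → Set
Numbering G n = V G ⤖ Fin n

label : ∀ {G n} → Numbering G n → V G → ℕ
label f v = suc (toℕ (Bijection.to f v))

IsStrF : (G : Graph) (n : ℕ) → Numbering G n → ℕ → Set
IsStrF G n f s =
  (∀ u v → Adj G u v → label {G} f u + label {G} f v ≤ s)
  × Σ (V G) (λ u → Σ (V G) (λ v → Adj G u v × (label {G} f u + label {G} f v ≡ s)))

-- str(G) = s : s is the minimum of str_f(G) over all numberings f
-- (G of order n). No s satisfies this if G has no edges (str = +∞).
IsStrength : (G : Graph) (n : ℕ) → ℕ → Set
IsStrength G n s =
  Σ (Numbering G n) (λ f → IsStrF G n f s)
  × (∀ (f : Numbering G n) t → IsStrF G n f t → s ≤ t)

MPVertex : ∀ {k} → (Fin k → ℕ) → Set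
MPVertex {k} ns = Σ (Fin k) (λ i → Fin (ns i))

MPAdj : ∀ {k} (ns : Fin k → ℕ) → MPVertex ns → MPVertex ns → Set
MPAdj ns (i , _) (j , _) = ¬ (i ≡ j)

completeMultipartite : ∀ {k} → (Fin k → ℕ) → Graph
completeMultipartite ns = record
  { V = MPVertex ns
  ; Adj = MPAdj ns
  ; sym = λ {u} {v} p q → p (symm q)
  ; irr = λ p → p Relation.Binary.PropositionalEquality.refl
  }
  where
  symm : ∀ {A : Set} {a b : A} → a ≡ b → b ≡ a
  symm = Relation.Binary.PropositionalEquality.sym

-- H = subgraph of K_{ns} induced by the parts other than part 0 (= V_1).
-- Edges of H: uv with u, v both outside part 0 and in different parts.
HAdj : ∀ {m} (ns : Fin (suc m) → ℕ) → MPVertex ns → MPVertex ns → Set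
HAdj ns u v = ¬ (proj₁ u ≡ zero) × ¬ (proj₁ v ≡ zero) × MPAdj ns u v

-- H' is a subgraph of H: its edge relation is symmetric and contained in E(H).
-- (Vertices of H' play no role in E(G) \ E(H').)
IsSubgraphOfH : ∀ {m} (ns : Fin (suc m) → ℕ) → (MPVertex ns → MPVertex ns → Set) → Set
IsSubgraphOfH ns R =
  (∀ u v → R u v → R v u) × (∀ u v → R u v → HAdj ns u v)

removeEdges : (G : Graph) (R : V G → V G → Set) → (∀ u v → R u v → R v u) → Graph
removeEdges G R Rsym = record
  { V = V G
  ; Adj = λ u v → Adj G u v × ¬ R u v
  ; sym = λ {u} {v} (a , nr) → sym G a , (λ r → nr (Rsym v u r))
  ; irr = λ (a , _) → irr G a
  }

{-# OPTIONS --safe #-}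
-- Write N = |V₁|, r = |V₂ ∪ … ∪ Vₖ| and n = N + r; both G and G′ have strength n + r.
-- Since V₁ is independent, every edge has an endpoint outside V₁, so numbering those r
-- vertices first bounds every edge sum by n + r. Conversely, let w carry label n in an
-- arbitrary numbering. If w ∈ V₁, the r vertices outside V₁ have distinct labels, so one
-- of them has label ≥ r; otherwise the N ≥ r vertices of V₁ include one with label ≥ N.
-- Either way that vertex is joined to w.
module Submission where

open import Defs
open import Data.Nat using (ℕ; suc; _≤_)
open import Data.Fin using (Fin; zero; suc)
open import Data.Product using (proj₁; _×_)
open import Function.Bundles using (_⇔_)

open import Data.Nat using (zero; _+_; s≤s)
open import Data.Nat.Properties using (_≤?_; ≤-trans; ≤-antisym; ≤-reflexive; +-comm; +-mono-≤; m≤m+n; m≤n+m; 1+n≰n; ≰⇒>)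
open import Data.Fin using (toℕ; fromℕ; fromℕ<; cast; _↑ˡ_)
open import Data.Fin.Properties using (_≟_; any?; injective⇒≤; toℕ-injective; toℕ-fromℕ; toℕ-fromℕ<; toℕ-cast; toℕ-↑ˡ; toℕ<n; cast-involutive; +↔⊎)
open import Data.Product using (Σ; ∃; _,_; proj₂)
open import Data.Sum using (_⊎_; inj₁; inj₂)
open import Data.Sum.Algebra using (⊎-comm; ⊎-cong)
open import Function.Base using (_∘_)
open import Function.Bundles using (_↔_; _⤖_; Inverse; Bijection; Injection; mk↔ₛ′; mk⇔)
open import Function.Definitions using (Injective)
open import Function.Properties.Inverse using (↔-refl; ↔-sym; ↔⇒⤖; ↔⇒↣)
open import Function.Construct.Composition using (_⇔-∘_)
open import Function.Construct.Symmetry using (⇔-sym)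
open import Function.Related.Propositional using (module EquationalReasoning)
open import Relation.Binary.PropositionalEquality as ≡ using (_≡_; refl; trans; cong; subst)
open import Relation.Nullary using (¬_; yes; no; contradiction)

injective⇒∃-large : ∀ {p n} (h : Fin p → Fin n) → Injective _≡_ _≡_ h → 1 ≤ p →
                    ∃ λ i → p ≤ suc (toℕ (h i))
injective⇒∃-large {suc p} h h-inj _ with any? (λ i → p ≤? toℕ (h i))
... | yes (i , p≤hi) = i , s≤s p≤hi
... | no ¬large = contradiction (injective⇒≤ squeeze-injective) 1+n≰n
  where
  squeeze : Fin (suc p) → Fin p
  squeeze i = fromℕ< (≰⇒> (λ p≤hi → ¬large (i , p≤hi)))

  squeeze-injective : Injective _≡_ _≡_ squeeze
  squeeze-injective e = h-inj (toℕ-injective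
    (trans (≡.sym (toℕ-fromℕ< _)) (trans (cong toℕ e) (toℕ-fromℕ< _))))

module _ {G : Graph} {n : ℕ} (f : Numbering G n) where

  open Bijection f using (to; injective; strictlySurjective)

  ∃-label≡order : 1 ≤ n → ∃ λ w → label {G} f w ≡ n
  ∃-label≡order (s≤s _) = w , trans (cong (suc ∘ toℕ) to-w) (cong suc (toℕ-fromℕ _))
    where
    w = proj₁ (strictlySurjective (fromℕ _))
    to-w = proj₂ (strictlySurjective (fromℕ _))

  ∃-label≥ : ∀ {p} (h : Fin p → V G) → Injective _≡_ _≡_ h → 1 ≤ p →
             ∃ λ i → p ≤ label {G} f (h i)
  ∃-label≥ h h-inj = injective⇒∃-large (to ∘ h) (h-inj ∘ injective)

EdgeWithSum≥ : (G : Graph) {n : ℕ} → Numbering G n → ℕ → Set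
EdgeWithSum≥ G f t = Σ (V G) λ u → Σ (V G) λ v → Adj G u v × (t ≤ label {G} f u + label {G} f v)

strength⇔≡ : ∀ {G n t} (f : Numbering G n) →
             (∀ u v → Adj G u v → label {G} f u + label {G} f v ≤ t) →
             (∀ g → EdgeWithSum≥ G {n} g t) →
             ∀ s → IsStrength G n s ⇔ s ≡ t
strength⇔≡ {G} {n} {t} f f-bound heavy s = mk⇔ strength≡t (λ { refl → (f , strF-f) , minimal })
  where
  strF-f : IsStrF G n f t
  strF-f = f-bound , let (u , v , a , t≤) = heavy f in
    u , v , a , ≤-antisym (f-bound u v a) t≤

  minimal : ∀ g t′ → IsStrF G n g t′ → t ≤ t′
  minimal g t′ (g-bound , _) = let (u , v , a , t≤) = heavy g in ≤-trans t≤ (g-bound u v a)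

  strength≡t : IsStrength G n s → s ≡ t
  strength≡t ((g , strF-g) , s-min) = ≤-antisym (s-min f t strF-f) (minimal g s strF-g)

cast↔ : ∀ {m n} → m ≡ n → Fin m ↔ Fin n
cast↔ eq = mk↔ₛ′ (cast eq) (cast (≡.sym eq)) (cast-involutive eq (≡.sym eq)) (cast-involutive (≡.sym eq) eq)

peel : ∀ {k} (ns : Fin (suc k) → ℕ) → MPVertex ns ↔ (Fin (ns zero) ⊎ MPVertex (ns ∘ suc))
peel ns = mk↔ₛ′ split unsplit split∘unsplit unsplit∘split
  where
  split : MPVertex ns → Fin (ns zero) ⊎ MPVertex (ns ∘ suc)
  split (zero , j) = inj₁ j
  split (suc i , j) = inj₂ (i , j)

  unsplit : Fin (ns zero) ⊎ MPVertex (ns ∘ suc) → MPVertex ns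
  unsplit (inj₁ j) = zero , j
  unsplit (inj₂ (i , j)) = suc i , j

  split∘unsplit : ∀ x → split (unsplit x) ≡ x
  split∘unsplit (inj₁ j) = refl
  split∘unsplit (inj₂ (i , j)) = refl

  unsplit∘split : ∀ v → unsplit (split v) ≡ v
  unsplit∘split (zero , j) = refl
  unsplit∘split (suc i , j) = refl

mpVertex↔Fin : ∀ {k} (ns : Fin k → ℕ) → MPVertex ns ↔ Fin (sumF ns)
mpVertex↔Fin {zero} ns = mk↔ₛ′ (λ { (() , _) }) (λ ()) (λ ()) (λ { (() , _) })
mpVertex↔Fin {suc k} ns = begin
  MPVertex ns                                ↔⟨ peel ns ⟩
  (Fin (ns zero) ⊎ MPVertex (ns ∘ suc))      ↔⟨ ⊎-cong ↔-refl (mpVertex↔Fin (ns ∘ suc)) ⟩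
  (Fin (ns zero) ⊎ Fin (sumF (ns ∘ suc)))    ↔⟨ +↔⊎ ⟨
  Fin (sumF ns)                              ∎
  where open EquationalReasoning

module _ {m : ℕ} (ns : Fin (suc m) → ℕ) where

  private
    N r : ℕ
    N = ns zero
    r = sumF (ns ∘ suc)

  Inside : MPVertex ns → Set
  Inside v = proj₁ v ≡ zero

  outer : Fin r → MPVertex ns
  outer y = let (i , j) = Inverse.from (mpVertex↔Fin (ns ∘ suc)) y in suc i , j

  outer-injective : Injective _≡_ _≡_ outer
  outer-injective = Injection.injective (↔⇒↣ (↔-sym (mpVertex↔Fin (ns ∘ suc)))) ∘ drop-suc
    where
    drop-suc : ∀ {p q : MPVertex (ns ∘ suc)} → (suc (proj₁ p) , proj₂ p) ≡ (suc (proj₁ q) , proj₂ q) → p ≡ q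
    drop-suc {_ , _} {_ , _} refl = refl

  inner : Fin N → MPVertex ns
  inner j = zero , j

  inner-injective : Injective _≡_ _≡_ inner
  inner-injective refl = refl

  outerFirst : MPVertex ns ⤖ Fin (sumF ns)
  outerFirst = ↔⇒⤖ (begin
    MPVertex ns                    ↔⟨ peel ns ⟩
    (Fin N ⊎ MPVertex (ns ∘ suc))  ↔⟨ ⊎-comm _ _ ⟩
    (MPVertex (ns ∘ suc) ⊎ Fin N)  ↔⟨ ⊎-cong (mpVertex↔Fin (ns ∘ suc)) ↔-refl ⟩
    (Fin r ⊎ Fin N)                ↔⟨ +↔⊎ ⟨
    Fin (r + N)                    ↔⟨ cast↔ (+-comm r N) ⟩
    Fin (N + r)                    ∎)
    where open EquationalReasoning

  outerFirst-outside : ∀ v → ¬ Inside v → suc (toℕ (Bijection.to outerFirst v)) ≤ r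
  outerFirst-outside (zero , j) outside = contradiction refl outside
  outerFirst-outside (suc i , j) _ = subst (_≤ r) (cong suc (≡.sym label≡)) (toℕ<n y)
    where
    y = Inverse.to (mpVertex↔Fin (ns ∘ suc)) (i , j)
    label≡ : toℕ (Bijection.to outerFirst (suc i , j)) ≡ toℕ y
    label≡ = trans (toℕ-cast _ (y ↑ˡ N)) (toℕ-↑ˡ y N)

module _ {m : ℕ} (ns : Fin (suc m) → ℕ)
  (r≥1 : 1 ≤ sumF (ns ∘ suc)) (r≤N : sumF (ns ∘ suc) ≤ ns zero)
  (A : MPVertex ns → MPVertex ns → Set) (A-sym : ∀ {u v} → A u v → A v u) (A-irr : ∀ {v} → ¬ A v v)
  (inside-outside : ∀ u v → Inside ns u → ¬ Inside ns v → A u v)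
  (inside-independent : ∀ u v → A u v → Inside ns u → ¬ Inside ns v)
  where

  private
    N r n : ℕ
    N = ns zero
    r = sumF (ns ∘ suc)
    n = sumF ns

    X : Graph
    X = record { V = MPVertex ns ; Adj = A ; sym = A-sym ; irr = A-irr }

  outerFirst-bound : ∀ u v → A u v → label {X} (outerFirst ns) u + label {X} (outerFirst ns) v ≤ n + r
  outerFirst-bound u v a with proj₁ u ≟ zero
  ... | yes u-in = +-mono-≤ (toℕ<n _) (outerFirst-outside ns v (inside-independent u v a u-in))
  ... | no u-out = ≤-trans (+-mono-≤ (outerFirst-outside ns u u-out) (toℕ<n _)) (≤-reflexive (+-comm r n))

  edgeWithSum≥n+r : ∀ g → EdgeWithSum≥ X {n} g (n + r)
  edgeWithSum≥n+r g with ∃-label≡order {X} g (≤-trans r≥1 (m≤n+m r N))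
  ... | w , label-w with proj₁ w ≟ zero
  ...   | yes w-in = let (i , r≤) = ∃-label≥ {X} g (outer ns) (outer-injective ns) r≥1 in
          w , outer ns i , inside-outside w (outer ns i) w-in (λ ()) ,
          +-mono-≤ (≤-reflexive (≡.sym label-w)) r≤
  ...   | no w-out = let (j , N≤) = ∃-label≥ {X} g (inner ns) (inner-injective ns) (≤-trans r≥1 r≤N) in
          inner ns j , w , inside-outside (inner ns j) w refl w-out ,
          ≤-trans (≤-reflexive (+-comm n r)) (+-mono-≤ (≤-trans r≤N N≤) (≤-reflexive (≡.sym label-w)))

  strength⇔≡n+r : ∀ s → IsStrength X n s ⇔ s ≡ n + r
  strength⇔≡n+r = strength⇔≡ {X} (outerFirst ns) outerFirst-bound edgeWithSum≥n+r

theorem2p5 : (m : ℕ) → 2 ≤ m → (ns : Fin (suc m) → ℕ) →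
    (∀ i → 1 ≤ ns i) → (∀ i → ns i ≤ ns zero) →
    sumF (λ i → ns (suc i)) ≤ ns zero →
    (R : MPVertex ns → MPVertex ns → Set) → (sub : IsSubgraphOfH ns R) →
    ∀ s → IsStrength (completeMultipartite ns) (sumF ns) s
          ⇔ IsStrength (removeEdges (completeMultipartite ns) R (proj₁ sub)) (sumF ns) s
theorem2p5 (suc m) _ ns positive _ r≤N R (R-sym , R⊆H) s = ⇔-sym G′-strength ⇔-∘ G-strength
  where
  G = completeMultipartite ns
  G′ = removeEdges G R R-sym

  r≥1 : 1 ≤ sumF (ns ∘ suc)
  r≥1 = ≤-trans (positive (suc zero)) (m≤m+n _ _)

  G-inside-outside : ∀ u v → Inside ns u → ¬ Inside ns v → Adj G u v
  G-inside-outside u v u-in v-out same = v-out (trans (≡.sym same) u-in)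

  G-inside-independent : ∀ u v → Adj G u v → Inside ns u → ¬ Inside ns v
  G-inside-independent u v uv u-in v-in = uv (trans u-in (≡.sym v-in))

  G′-inside-outside : ∀ u v → Inside ns u → ¬ Inside ns v → Adj G′ u v
  G′-inside-outside u v u-in v-out = G-inside-outside u v u-in v-out , λ uv∈R → proj₁ (R⊆H u v uv∈R) u-in

  G′-inside-independent : ∀ u v → Adj G′ u v → Inside ns u → ¬ Inside ns v
  G′-inside-independent u v = G-inside-independent u v ∘ proj₁

  G-strength : IsStrength G (sumF ns) s ⇔ s ≡ sumF ns + sumF (ns ∘ suc)
  G-strength = strength⇔≡n+r ns r≥1 r≤N (Adj G) (λ {u} {v} → Graph.sym G {u} {v}) (λ {v} → irr G {v})
    G-inside-outside G-inside-independent s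

  G′-strength : IsStrength G′ (sumF ns) s ⇔ s ≡ sumF ns + sumF (ns ∘ suc)
  G′-strength = strength⇔≡n+r ns r≥1 r≤N (Adj G′) (λ {u} {v} → Graph.sym G′ {u} {v}) (λ {v} → irr G′ {v})
    G′-inside-outside G′-inside-independent s
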